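{- Let $0\leq k\leq 2n-1$ with $k$ odd, and let $\mathbf{w}=(w_{i})_{1\leq i\leq l}$ be an eigenvector of $\bar D_{k}$ belonging to the eigenvalue $\lambda$. If $\mathbf{w}$ is linearly independent of the vector $\begin{pmatrix}\mathbf{0}_{l-1}\\ 1\end{pmatrix}$, then \begin{align*} \begin{pmatrix} w_{1}\mathbf{z}_{2n,k}\\ \vdots\\ w_{l-1}\mathbf{z}_{2n,k}\\ \mathbf{0}_{n} \end{pmatrix}\in\mathbb{C}^{2(l-1)n} \end{align*} is an eigenvector of $D$ belonging to $\lambda$. Here $\mathbf{0}_{p}$ denotes the zero vector of length $p$.
   Context: Let $l,n$ be positive integers. A square matrix of size $p$ is called cyclic (circulant) if its $(r,s)$ entry depends only on $s-r \bmod p$. For a matrix $X$, $X^{(1)}$ denotes its first row. Let $\zeta_{p}$ be a primitive $p$th root of unity and $\mathbf{z}_{p,k}=(1,\zeta_{p}^{k},\zeta_{p}^{2k},\ldots,\zeta_{p}^{(p-1)k})^{T}$. Let $D=(D^{ij})_{1\leq i,j\leq l}$ be a block matrix where $D^{ij}$ is a $2n\times 2n$ cyclic matrix for $1\leq i,j\leq l-1$, $D^{ll}$ is an $n\times n$ cyclic matrix, and for $1\leq i,j\leq l-1$, $D^{il}=\begin{pmatrix}X_{i}\\ X_{i}\end{pmatrix}$, $D^{lj}=\begin{pmatrix}Y_{j}&Y_{j}\end{pmatrix}$ with $X_{i},Y_{j}$ $n\times n$ cyclic matrices. For $0\leq k\leq 2n-1$ define the $l\times l$ matrix $\bar D_{k}=(d^{(k)}_{ij})_{1\leq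 i,j\leq l}$: if $k$ is even, $d^{(k)}_{ij}=(D^{ij})^{(1)}\mathbf{z}_{2n,k}$ for $1\leq j\leq l-1$ and $d^{(k)}_{il}=(D^{il})^{(1)}\mathbf{z}_{n,k/2}$; if $k$ is odd, $d^{(k)}_{ij}=(D^{ij})^{(1)}\mathbf{z}_{2n,k}$ for $1\leq j\leq l-1$ and $d^{(k)}_{il}=0$. -}

module Defs where

open import Level using (_⊔_)
open import Algebra.Bundles using (CommutativeRing)
open import Data.Nat as ℕ using (ℕ; zero; suc; _<_; NonZero)
open import Data.Nat.DivMod using (_%_; _/_; m%n<n)
open import Data.Fin using (Fin; toℕ; fromℕ<; splitAt; remQuot; _↑ˡ_)
open import Data.Fin.Properties using (nonZeroIndex)
open import Data.Sum using (_⊎_; inj₁; inj₂; [_,_]′)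
open import Data.Product using (_×_; _,_; Σ)
open import Function using (id)
open import Relation.Nullary using (¬_)

module _ {c ℓ} (R : CommutativeRing c ℓ) where
  open CommutativeRing R

  Vect : ℕ → Set c
  Vect m = Fin m → Carrier

  Mat : ℕ → ℕ → Set c
  Mat m p = Fin m → Fin p → Carrier

  Σ⟨_⟩ : ∀ {m} → Vect m → Carrier
  Σ⟨_⟩ {zero}  v = 0#
  Σ⟨_⟩ {suc m} v = v Fin.zero + Σ⟨_⟩ {m} (λ j → v (Fin.suc j))

  dot : ∀ {m} → Vect m → Vect m → Carrier
  dot u v = Σ⟨ (λ j → u j * v j) ⟩

  mulV : ∀ {m p} → Mat m p → Vect p → Vect m
  mulV M v i = dot (M i) v

  pow : Carrier → ℕ → Carrier
  pow x zero    = 1#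
  pow x (suc e) = x * pow x e

  IsPrimitiveRoot : ℕ → Carrier → Set ℓ
  IsPrimitiveRoot p ζ = (pow ζ p ≈ 1#) × (∀ j → 0 < j → j < p → ¬ (pow ζ j ≈ 1#))

  IsField : Set (c ⊔ ℓ)
  IsField = (¬ (1# ≈ 0#)) × (∀ x → ¬ (x ≈ 0#) → Σ Carrier (λ y → x * y ≈ 1#))

  zvec : (p : ℕ) → Carrier → ℕ → Vect p
  zvec p ζ k j = pow ζ (toℕ j ℕ.* k)

  diffMod : ∀ {p} → Fin p → Fin p → Fin p
  diffMod {p} r s = fromℕ< (m%n<n (toℕ s ℕ.+ (p ℕ.∸ toℕ r)) p {{nonZeroIndex r}})

  -- the cyclic (circulant) p×p matrix with first row c₀: entry (r,s) = c₀ (s - r mod p)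
  circ : ∀ {p} → Vect p → Mat p p
  circ c₀ r s = c₀ (diffMod r s)

  -- fold an index of Fin (n + n) to Fin n (row/column i and i+n of [X;X] / [Y Y])
  fold2 : ∀ n → Fin (n ℕ.+ n) → Fin n
  fold2 n i = [ id , id ]′ (splitAt n i)

  -- The block matrix D of size 2(l-1)n + n, where l = L + 1 and 2n is written n + n.
  -- A i j : first row of the 2n×2n cyclic block D^{ij}  (i,j < l)
  -- X i   : first row of the n×n cyclic matrix X_i   (D^{il} = [X_i ; X_i])
  -- Y j   : first row of the n×n cyclic matrix Y_j   (D^{lj} = [Y_j  Y_j])
  -- B     : first row of the n×n cyclic block D^{ll}
  blockIdx : ∀ L n → Fin (L ℕ.* (n ℕ.+ n) ℕ.+ n) → (Fin L × Fin (n ℕ.+ n)) ⊎ Fin n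
  blockIdx L n a with splitAt (L ℕ.* (n ℕ.+ n)) a
  ... | inj₁ b = inj₁ (remQuot (n ℕ.+ n) b)
  ... | inj₂ t = inj₂ t

  bigD : ∀ L n → (A : Fin L → Fin L → Vect (n ℕ.+ n)) → (X Y : Fin L → Vect n) → (B : Vect n)
       → Mat (L ℕ.* (n ℕ.+ n) ℕ.+ n) (L ℕ.* (n ℕ.+ n) ℕ.+ n)
  bigD L n A X Y B a b with blockIdx L n a | blockIdx L n b
  ... | inj₁ (i , r) | inj₁ (j , s) = circ (A i j) r s
  ... | inj₁ (i , r) | inj₂ s       = circ (X i) (fold2 n r) s
  ... | inj₂ r       | inj₁ (j , s) = circ (Y j) r (fold2 n s)
  ... | inj₂ r       | inj₂ s       = circ B r s

  -- The l×l matrix \bar D_k (l = L + 1; index inj₂ of splitAt L is the last index l).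
  -- ζ2n, ζn: the chosen primitive 2n-th and n-th roots of unity.
  Dbar : ∀ L n → (A : Fin L → Fin L → Vect (n ℕ.+ n)) → (X Y : Fin L → Vect n) → (B : Vect n)
       → (ζ2n ζn : Carrier) → ℕ → Mat (L ℕ.+ 1) (L ℕ.+ 1)
  Dbar L n A X Y B ζ2n ζn k a b with splitAt L a | splitAt L b | k % 2
  ... | inj₁ i | inj₁ j | _     = dot (A i j) (zvec (n ℕ.+ n) ζ2n k)
  ... | inj₂ _ | inj₁ j | _     = dot (λ s → Y j (fold2 n s)) (zvec (n ℕ.+ n) ζ2n k)
  ... | inj₁ i | inj₂ _ | zero  = dot (X i) (zvec n ζn (k / 2))
  ... | inj₂ _ | inj₂ _ | zero  = dot B (zvec n ζn (k / 2))
  ... | _      | inj₂ _ | suc _ = 0#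

  IsEigenvector : ∀ {m} → Mat m m → Carrier → Vect m → Set ℓ
  IsEigenvector M λ' v = (¬ (∀ i → v i ≈ 0#)) × (∀ i → mulV M v i ≈ λ' * v i)

  LinIndep : ∀ {m} → Vect m → Vect m → Set (c ⊔ ℓ)
  LinIndep u v = ∀ a b → (∀ i → a * u i + b * v i ≈ 0#) → (a ≈ 0#) × (b ≈ 0#)

  lastUnit : ∀ L → Vect (L ℕ.+ 1)
  lastUnit L a = [ (λ _ → 0#) , (λ _ → 1#) ]′ (splitAt L a)

  liftVec : ∀ L n → Vect (L ℕ.+ 1) → Carrier → ℕ → Vect (L ℕ.* (n ℕ.+ n) ℕ.+ n)
  liftVec L n w ζ2n k a with blockIdx L n a
  ... | inj₁ (i , r) = w (i ↑ˡ 1) * zvec (n ℕ.+ n) ζ2n k r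
  ... | inj₂ _       = 0#

-- For odd k the last column of \bar D_k vanishes, so the eigen-equation of w says, for its first
-- l - 1 rows, Σ_j ((D^{ij})^{(1)} z) w_j = λ w_i with z = z_{2n,k}. Every circulant C with first row c
-- satisfies C z = (c · z) z, because the summands c_{s mod 2n} ζ^{sk} are 2n-periodic in s; hence the
-- upper block rows of D map the lift to λ (w_i z). In the bottom block row, [Y_j Y_j] z = 0: over a
-- field the primitive 2n-th root ζ satisfies ζ^n = -1 (its square is 1 and it is not 1), so for odd k
-- the second half of z is minus the first. Finally the lift is nonzero, for otherwise w_1 = … =
-- w_{l-1} = 0 and w would be a multiple of (0_{l-1}; 1).
module Submission where

open import Defs
open import Algebra.Bundles using (CommutativeRing)
import Data.Nat as ℕ
open ℕ using (ℕ; zero; suc; _<_; NonZero)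
import Data.Nat.Properties as ℕₚ
open import Data.Nat.DivMod using (_%_; _/_; m%n<n; m<n⇒m%n≡m; m≡m%n+[m/n]*n; [m+n]%n≡m%n)
open import Data.Nat.Tactic.RingSolver using (solve-∀)
open import Data.Fin as Fin using (Fin; toℕ; fromℕ<; splitAt; combine; _↑ˡ_; _↑ʳ_)
import Data.Fin.Properties as Finₚ
open import Data.Sum using (_⊎_; inj₁; inj₂; [_,_]′)
open import Data.Product using (_×_; _,_; proj₁; proj₂)
open import Function using (id)
open import Relation.Binary.PropositionalEquality as ≡ using (_≡_)
open import Relation.Nullary using (¬_)

module _ {c ℓ} (R : CommutativeRing c ℓ) where
  open CommutativeRing R
  open import Algebra.Properties.Semiring.Sum semiring
    using (sum; sum-cong-≋; sum-cong-≗; sum-replicate-zero; sum-init-last; *-distribˡ-sum; *-distribʳ-sum)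
  open import Algebra.Properties.Semiring.Exp semiring using (_^_; ^-homo-*)
  open import Algebra.Properties.Ring ring using (-1*x≈-x)
  open import Algebra.Properties.CommutativeSemigroup *-commutativeSemigroup using (x∙yz≈y∙xz; x∙yz≈y∙zx)
  open import Algebra.Properties.Group +-group using (inverseˡ-unique; x∙y⁻¹≈ε⇒x≈y)
  open import Relation.Binary.Reasoning.Setoid setoid

  Σ⟨⟩≡sum : ∀ {m} (v : Vect R m) → Σ⟨_⟩ R v ≡ sum v
  Σ⟨⟩≡sum {zero}  v = ≡.refl
  Σ⟨⟩≡sum {suc m} v = ≡.cong (v Fin.zero +_) (Σ⟨⟩≡sum (λ j → v (Fin.suc j)))

  dot≈sum : ∀ {m} (u v : Vect R m) → dot R u v ≈ sum (λ j → u j * v j)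
  dot≈sum u v = reflexive (Σ⟨⟩≡sum (λ j → u j * v j))

  sum≈0 : ∀ {m} {v : Vect R m} → (∀ i → v i ≈ 0#) → sum v ≈ 0#
  sum≈0 {m} v≈0 = trans (sum-cong-≋ v≈0) (sum-replicate-zero m)

  sum-↑ˡ-↑ʳ : ∀ m {p} (v : Vect R (m ℕ.+ p)) →
              sum v ≈ sum (λ i → v (i ↑ˡ p)) + sum (λ j → v (m ↑ʳ j))
  sum-↑ˡ-↑ʳ zero    v = sym (+-identityˡ _)
  sum-↑ˡ-↑ʳ (suc m) v = trans (+-congˡ (sum-↑ˡ-↑ʳ m (λ i → v (Fin.suc i)))) (sym (+-assoc _ _ _))

  sum-combine : ∀ m {p} (v : Vect R (m ℕ.* p)) →
                sum v ≈ sum (λ i → sum (λ j → v (combine {m} {p} i j)))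
  sum-combine zero        v = refl
  sum-combine (suc m) {p} v = trans (sum-↑ˡ-↑ʳ p v) (+-congˡ (sum-combine m {p} (λ b → v (p ↑ʳ b))))

  sum-snoc : ∀ m (f : ℕ → Carrier) →
             sum {suc m} (λ i → f (toℕ i)) ≈ sum {m} (λ i → f (toℕ i)) + f m
  sum-snoc m f = trans (sum-init-last {m} (λ i → f (toℕ i))) (+-cong
    (reflexive (sum-cong-≗ {m} (λ i → ≡.cong f (Finₚ.toℕ-inject₁ i))))
    (reflexive (≡.cong f (Finₚ.toℕ-fromℕ m))))

  sum-rotate : ∀ m (f : ℕ → Carrier) → f m ≈ f 0 →
               sum {m} (λ i → f (suc (toℕ i))) ≈ sum {m} (λ i → f (toℕ i))
  sum-rotate zero    f _     = refl
  sum-rotate (suc m) f fm≈f0 = begin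
    sum {suc m} (λ i → f (suc (toℕ i)))          ≈⟨ sum-snoc m (λ s → f (suc s)) ⟩
    sum {m} (λ i → f (suc (toℕ i))) + f (suc m)  ≈⟨ +-congˡ fm≈f0 ⟩
    sum {m} (λ i → f (suc (toℕ i))) + f 0        ≈⟨ +-comm _ _ ⟩
    f 0 + sum {m} (λ i → f (suc (toℕ i)))        ∎

  sum-periodic-shift : ∀ m (f : ℕ → Carrier) → (∀ s → f (s ℕ.+ m) ≈ f s) → ∀ r →
                       sum {m} (λ i → f (toℕ i ℕ.+ r)) ≈ sum {m} (λ i → f (toℕ i))
  sum-periodic-shift m f periodic zero =
    reflexive (sum-cong-≗ {m} (λ i → ≡.cong f (ℕₚ.+-identityʳ (toℕ i))))
  sum-periodic-shift m f periodic (suc r) = begin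
    sum {m} (λ i → f (toℕ i ℕ.+ suc r))
      ≡⟨ sum-cong-≗ {m} (λ i → ≡.cong f (ℕₚ.+-suc (toℕ i) r)) ⟩
    sum {m} (λ i → f (suc (toℕ i ℕ.+ r)))
      ≈⟨ sum-periodic-shift m (λ s → f (suc s)) (λ s → periodic (suc s)) r ⟩
    sum {m} (λ i → f (suc (toℕ i)))
      ≈⟨ sum-rotate m f (periodic 0) ⟩
    sum {m} (λ i → f (toℕ i))
      ∎

  pow≡^ : ∀ x e → pow R x e ≡ x ^ e
  pow≡^ x zero    = ≡.refl
  pow≡^ x (suc e) = ≡.cong (x *_) (pow≡^ x e)

  pow-+ : ∀ x a b → pow R x (a ℕ.+ b) ≈ pow R x a * pow R x b
  pow-+ x a b rewrite pow≡^ x (a ℕ.+ b) | pow≡^ x a | pow≡^ x b = ^-homo-* x a b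

  pow-*≈1 : ∀ {x m} → pow R x m ≈ 1# → ∀ k → pow R x (m ℕ.* k) ≈ 1#
  pow-*≈1 {x} {m} x^m≈1 zero    = reflexive (≡.cong (pow R x) (ℕₚ.*-zeroʳ m))
  pow-*≈1 {x} {m} x^m≈1 (suc k) = begin
    pow R x (m ℕ.* suc k)          ≡⟨ ≡.cong (pow R x) (ℕₚ.*-suc m k) ⟩
    pow R x (m ℕ.+ m ℕ.* k)        ≈⟨ pow-+ x m (m ℕ.* k) ⟩
    pow R x m * pow R x (m ℕ.* k)  ≈⟨ *-cong x^m≈1 (pow-*≈1 {x} {m} x^m≈1 k) ⟩
    1# * 1#                        ≈⟨ *-identityˡ 1# ⟩
    1#                             ∎

  pow-*-distribʳ-+ : ∀ x k a b → pow R x ((a ℕ.+ b) ℕ.* k) ≈ pow R x (a ℕ.* k) * pow R x (b ℕ.* k)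
  pow-*-distribʳ-+ x k a b =
    trans (reflexive (≡.cong (pow R x) (ℕₚ.*-distribʳ-+ k a b))) (pow-+ x (a ℕ.* k) (b ℕ.* k))

  pow-*-periodic : ∀ {x m} → pow R x m ≈ 1# → ∀ k s → pow R x ((s ℕ.+ m) ℕ.* k) ≈ pow R x (s ℕ.* k)
  pow-*-periodic {x} {m} x^m≈1 k s = begin
    pow R x ((s ℕ.+ m) ℕ.* k)              ≈⟨ pow-*-distribʳ-+ x k s m ⟩
    pow R x (s ℕ.* k) * pow R x (m ℕ.* k)  ≈⟨ *-congˡ (pow-*≈1 {x} {m} x^m≈1 k) ⟩
    pow R x (s ℕ.* k) * 1#                 ≈⟨ *-identityʳ _ ⟩
    pow R x (s ℕ.* k)                      ∎

  pow-*-odd : ∀ {x} n → pow R x (n ℕ.+ n) ≈ 1# → ∀ k → k % 2 ≡ 1 → pow R x (n ℕ.* k) ≈ pow R x n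
  pow-*-odd {x} n x^2n≈1 k k-odd = begin
    pow R x (n ℕ.* k)                      ≡⟨ ≡.cong (pow R x) n*k≡n+2n*q ⟩
    pow R x (n ℕ.+ (n ℕ.+ n) ℕ.* q)        ≈⟨ pow-+ x n _ ⟩
    pow R x n * pow R x ((n ℕ.+ n) ℕ.* q)  ≈⟨ *-congˡ (pow-*≈1 {x} {n ℕ.+ n} x^2n≈1 q) ⟩
    pow R x n * 1#                         ≈⟨ *-identityʳ _ ⟩
    pow R x n                              ∎
    where
    q : ℕ
    q = k / 2
    n*[1+q*2] : ∀ n q → n ℕ.* (1 ℕ.+ q ℕ.* 2) ≡ n ℕ.+ (n ℕ.+ n) ℕ.* q
    n*[1+q*2] = solve-∀
    n*k≡n+2n*q : n ℕ.* k ≡ n ℕ.+ (n ℕ.+ n) ℕ.* q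
    n*k≡n+2n*q = ≡.trans
      (≡.cong (n ℕ.*_) (≡.trans (m≡m%n+[m/n]*n k 2) (≡.cong (ℕ._+ q ℕ.* 2) k-odd)))
      (n*[1+q*2] n q)

  x≉0⇒x*y≈0⇒y≈0 : IsField R → ∀ {x y} → ¬ (x ≈ 0#) → x * y ≈ 0# → y ≈ 0#
  x≉0⇒x*y≈0⇒y≈0 (_ , inverse) {x} {y} x≉0 xy≈0 = begin
    y              ≈⟨ *-identityˡ y ⟨
    1# * y         ≈⟨ *-congʳ (trans (sym x⁻¹-inverse) (*-comm x x⁻¹)) ⟩
    (x⁻¹ * x) * y  ≈⟨ *-assoc x⁻¹ x y ⟩
    x⁻¹ * (x * y)  ≈⟨ *-congˡ xy≈0 ⟩
    x⁻¹ * 0#       ≈⟨ zeroʳ x⁻¹ ⟩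
    0#             ∎
    where
    x⁻¹ : Carrier
    x⁻¹ = proj₁ (inverse x x≉0)
    x⁻¹-inverse : x * x⁻¹ ≈ 1#
    x⁻¹-inverse = proj₂ (inverse x x≉0)

  square≈1⇒≈-1 : IsField R → ∀ {y} → y * y ≈ 1# → ¬ (y ≈ 1#) → y ≈ - 1#
  square≈1⇒≈-1 isField {y} y²≈1 y≉1 =
    inverseˡ-unique y 1# (x≉0⇒x*y≈0⇒y≈0 isField y-1≉0 factorised)
    where
    y-1≉0 : ¬ (y - 1# ≈ 0#)
    y-1≉0 y-1≈0 = y≉1 (x∙y⁻¹≈ε⇒x≈y y 1# y-1≈0)
    factorised : (y - 1#) * (y + 1#) ≈ 0#
    factorised = begin
      (y - 1#) * (y + 1#)             ≈⟨ distribʳ (y + 1#) y (- 1#) ⟩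
      y * (y + 1#) + - 1# * (y + 1#)  ≈⟨ +-cong (distribˡ y y 1#) (-1*x≈-x (y + 1#)) ⟩
      (y * y + y * 1#) - (y + 1#)     ≈⟨ +-congʳ (+-cong y²≈1 (*-identityʳ y)) ⟩
      (1# + y) - (y + 1#)             ≈⟨ +-congʳ (+-comm 1# y) ⟩
      (y + 1#) - (y + 1#)             ≈⟨ -‿inverseʳ (y + 1#) ⟩
      0#                              ∎

  primitiveRoot-pow-half : IsField R → ∀ n {ζ} → 0 < n → IsPrimitiveRoot R (n ℕ.+ n) ζ →
                           pow R ζ n ≈ - 1#
  primitiveRoot-pow-half isField n {ζ} 0<n (ζ^2n≈1 , ζ^j≉1) =
    square≈1⇒≈-1 isField (trans (sym (pow-+ ζ n n)) ζ^2n≈1) (ζ^j≉1 n 0<n (ℕₚ.m<m+n n 0<n))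

  cyclicExtension : ∀ {m} → .{{NonZero m}} → Vect R m → ℕ → Carrier
  cyclicExtension {m} c t = c (fromℕ< (m%n<n t m))

  cyclicExtension-toℕ : ∀ {m} .{{_ : NonZero m}} (c : Vect R m) s → cyclicExtension c (toℕ s) ≡ c s
  cyclicExtension-toℕ {m} c s = ≡.cong c (≡.trans
    (Finₚ.fromℕ<-cong _ _ (m<n⇒m%n≡m (Finₚ.toℕ<n s)) (m%n<n (toℕ s) m) (Finₚ.toℕ<n s))
    (Finₚ.fromℕ<-toℕ s (Finₚ.toℕ<n s)))

  cyclicExtension-periodic : ∀ {m} .{{_ : NonZero m}} (c : Vect R m) t →
                             cyclicExtension c (t ℕ.+ m) ≡ cyclicExtension c t
  cyclicExtension-periodic {m} c t =
    ≡.cong c (Finₚ.fromℕ<-cong _ _ ([m+n]%n≡m%n t m) (m%n<n (t ℕ.+ m) m) (m%n<n t m))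

  circ-zvec : ∀ {m ζ} → pow R ζ m ≈ 1# → ∀ k (c : Vect R m) (r : Fin m) →
              mulV R (circ R c) (zvec R m ζ k) r ≈ zvec R m ζ k r * dot R c (zvec R m ζ k)
  circ-zvec {m} {ζ} ζ^m≈1 k c r = begin
    mulV R (circ R c) z r
      ≈⟨ dot≈sum (circ R c r) z ⟩
    sum {m} (λ s → circ R c r s * z s)
      ≈⟨ sum-cong-≋ {m} (λ s → *-congˡ (pow-shift (toℕ s))) ⟩
    sum {m} (λ s → c′ (toℕ s ℕ.+ ρ′) * (ζ^ (toℕ s ℕ.+ ρ′) * ζ^ ρ))
      ≈⟨ sum-cong-≋ {m} (λ s → sym (*-assoc _ _ _)) ⟩
    sum {m} (λ s → h (toℕ s ℕ.+ ρ′) * ζ^ ρ)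
      ≈⟨ *-distribʳ-sum (ζ^ ρ) (λ s → h (toℕ {m} s ℕ.+ ρ′)) ⟨
    sum {m} (λ s → h (toℕ s ℕ.+ ρ′)) * ζ^ ρ
      ≈⟨ *-congʳ (sum-periodic-shift m h h-periodic ρ′) ⟩
    sum {m} (λ s → h (toℕ s)) * ζ^ ρ
      ≈⟨ *-congʳ (sum-cong-≋ {m} (λ s → *-congʳ (reflexive (cyclicExtension-toℕ c s)))) ⟩
    sum {m} (λ s → c s * z s) * z r
      ≈⟨ *-comm _ _ ⟩
    z r * sum {m} (λ s → c s * z s)
      ≈⟨ *-congˡ (dot≈sum c z) ⟨
    z r * dot R c z
      ∎
    where
    instance
      m≢0 : NonZero m
      m≢0 = Finₚ.nonZeroIndex r
    z : Vect R m
    z = zvec R m ζ k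
    ζ^ : ℕ → Carrier
    ζ^ t = pow R ζ (t ℕ.* k)
    ρ ρ′ : ℕ
    ρ  = toℕ r
    ρ′ = m ℕ.∸ ρ
    -- By the definition of diffMod, circ R c r s is c′ (toℕ s ℕ.+ ρ′).
    c′ : ℕ → Carrier
    c′ = cyclicExtension c
    h : ℕ → Carrier
    h t = c′ t * ζ^ t
    h-periodic : ∀ t → h (t ℕ.+ m) ≈ h t
    h-periodic t = *-cong (reflexive (cyclicExtension-periodic c t)) (pow-*-periodic ζ^m≈1 k t)
    pow-shift : ∀ s → ζ^ s ≈ ζ^ (s ℕ.+ ρ′) * ζ^ ρ
    pow-shift s = begin
      ζ^ s                  ≈⟨ pow-*-periodic ζ^m≈1 k s ⟨
      ζ^ (s ℕ.+ m)          ≡⟨ ≡.cong ζ^ (≡.trans (ℕₚ.+-assoc s ρ′ ρ) (≡.cong (s ℕ.+_) ρ′+ρ≡m)) ⟨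
      ζ^ (s ℕ.+ ρ′ ℕ.+ ρ)   ≈⟨ pow-*-distribʳ-+ ζ k (s ℕ.+ ρ′) ρ ⟩
      ζ^ (s ℕ.+ ρ′) * ζ^ ρ  ∎
      where
      ρ′+ρ≡m : ρ′ ℕ.+ ρ ≡ m
      ρ′+ρ≡m = ℕₚ.m∸n+n≡m (ℕₚ.<⇒≤ (Finₚ.toℕ<n r))

  fold2-↑ˡ : ∀ n (s : Fin n) → fold2 R n (s ↑ˡ n) ≡ s
  fold2-↑ˡ n s = ≡.cong [ id , id ]′ (Finₚ.splitAt-↑ˡ n s n)

  fold2-↑ʳ : ∀ n (s : Fin n) → fold2 R n (n ↑ʳ s) ≡ s
  fold2-↑ʳ n s = ≡.cong [ id , id ]′ (Finₚ.splitAt-↑ʳ n n s)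

  dot-fold2-zvec≈0 : ∀ n {ζ} k → pow R ζ (n ℕ.* k) ≈ - 1# → (u : Vect R n) →
                     dot R (λ s → u (fold2 R n s)) (zvec R (n ℕ.+ n) ζ k) ≈ 0#
  dot-fold2-zvec≈0 n {ζ} k ζ^nk≈-1 u = begin
    dot R (λ s → u (fold2 R n s)) z
      ≈⟨ dot≈sum (λ s → u (fold2 R n s)) z ⟩
    sum (λ s → u (fold2 R n s) * z s)
      ≈⟨ sum-↑ˡ-↑ʳ n _ ⟩
    sum (λ s → u (fold2 R n (s ↑ˡ n)) * z (s ↑ˡ n)) + sum (λ s → u (fold2 R n (n ↑ʳ s)) * z (n ↑ʳ s))
      ≈⟨ +-cong (sum-cong-≋ {n} first-half) (sum-cong-≋ {n} second-half) ⟩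
    S + sum (λ s → - 1# * (u s * ζ^ (toℕ s)))
      ≈⟨ +-congˡ (*-distribˡ-sum (- 1#) (λ s → u s * ζ^ (toℕ s))) ⟨
    S + - 1# * S
      ≈⟨ +-congˡ (-1*x≈-x S) ⟩
    S - S
      ≈⟨ -‿inverseʳ S ⟩
    0#
      ∎
    where
    z : Vect R (n ℕ.+ n)
    z = zvec R (n ℕ.+ n) ζ k
    ζ^ : ℕ → Carrier
    ζ^ t = pow R ζ (t ℕ.* k)
    S : Carrier
    S = sum (λ s → u s * ζ^ (toℕ s))
    first-half : ∀ s → u (fold2 R n (s ↑ˡ n)) * z (s ↑ˡ n) ≈ u s * ζ^ (toℕ s)
    first-half s = reflexive (≡.cong₂ (λ i t → u i * ζ^ t) (fold2-↑ˡ n s) (Finₚ.toℕ-↑ˡ s n))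
    second-half : ∀ s → u (fold2 R n (n ↑ʳ s)) * z (n ↑ʳ s) ≈ - 1# * (u s * ζ^ (toℕ s))
    second-half s = begin
      u (fold2 R n (n ↑ʳ s)) * z (n ↑ʳ s)
        ≡⟨ ≡.cong₂ (λ i t → u i * ζ^ t) (fold2-↑ʳ n s) (Finₚ.toℕ-↑ʳ n s) ⟩
      u s * ζ^ (n ℕ.+ toℕ s)     ≈⟨ *-congˡ (pow-*-distribʳ-+ ζ k n (toℕ s)) ⟩
      u s * (ζ^ n * ζ^ (toℕ s))  ≈⟨ *-congˡ (*-congʳ ζ^nk≈-1) ⟩
      u s * (- 1# * ζ^ (toℕ s))  ≈⟨ x∙yz≈y∙xz _ _ _ ⟩
      - 1# * (u s * ζ^ (toℕ s))  ∎

  module BlockMatrix (L n : ℕ) (A : Fin L → Fin L → Vect R (n ℕ.+ n)) (X Y : Fin L → Vect R n)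
                     (B : Vect R n) where

    BlockIndex : Set
    BlockIndex = (Fin L × Fin (n ℕ.+ n)) ⊎ Fin n

    private
      q N : ℕ
      q = n ℕ.+ n
      N = L ℕ.* q ℕ.+ n
      D : Mat R N N
      D = bigD R L n A X Y B
      idx : Fin N → BlockIndex
      idx = blockIdx R L n

    blockEntry : BlockIndex → BlockIndex → Carrier
    blockEntry (inj₁ (i , r)) (inj₁ (j , s)) = circ R (A i j) r s
    blockEntry (inj₁ (i , r)) (inj₂ s)       = circ R (X i) (fold2 R n r) s
    blockEntry (inj₂ r)       (inj₁ (j , s)) = circ R (Y j) r (fold2 R n s)
    blockEntry (inj₂ r)       (inj₂ s)       = circ R B r s

    blockRow : BlockIndex → Fin L → Vect R q
    blockRow p j s = blockEntry p (inj₁ (j , s))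

    bigD≡blockEntry : ∀ a b → D a b ≡ blockEntry (idx a) (idx b)
    bigD≡blockEntry a b with idx a | idx b
    ... | inj₁ _ | inj₁ _ = ≡.refl
    ... | inj₁ _ | inj₂ _ = ≡.refl
    ... | inj₂ _ | inj₁ _ = ≡.refl
    ... | inj₂ _ | inj₂ _ = ≡.refl

    blockIdx-combine : ∀ j s → idx (combine {L} {q} j s ↑ˡ n) ≡ inj₁ (j , s)
    blockIdx-combine j s rewrite Finₚ.splitAt-↑ˡ (L ℕ.* q) (combine {L} {q} j s) n =
      ≡.cong inj₁ (Finₚ.remQuot-combine j s)

    blockIdx-↑ʳ : ∀ t → idx (L ℕ.* q ↑ʳ t) ≡ inj₂ t
    blockIdx-↑ʳ t rewrite Finₚ.splitAt-↑ʳ (L ℕ.* q) n t = ≡.refl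

    sum-blockIdx : (f : BlockIndex → Carrier) →
                   sum (λ b → f (idx b)) ≈ sum (λ j → sum (λ s → f (inj₁ (j , s)))) + sum (λ t → f (inj₂ t))
    sum-blockIdx f = begin
      sum (λ b → f (idx b))
        ≈⟨ sum-↑ˡ-↑ʳ (L ℕ.* q) _ ⟩
      sum (λ b → f (idx (b ↑ˡ n))) + sum (λ t → f (idx (L ℕ.* q ↑ʳ t)))
        ≈⟨ +-cong (sum-combine L _) (reflexive (sum-cong-≗ {n} (λ t → ≡.cong f (blockIdx-↑ʳ t)))) ⟩
      sum (λ j → sum (λ s → f (idx (combine {L} {q} j s ↑ˡ n)))) + sum (λ t → f (inj₂ t))
        ≈⟨ +-congʳ (reflexive (sum-cong-≗ {L} (λ j → sum-cong-≗ {q} (λ s → ≡.cong f (blockIdx-combine j s))))) ⟩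
      sum (λ j → sum (λ s → f (inj₁ (j , s)))) + sum (λ t → f (inj₂ t))
        ∎

    module _ (ζ : Carrier) (k : ℕ) (w : Vect R (L ℕ.+ 1)) where

      private
        z : Vect R q
        z = zvec R q ζ k
        v : Vect R N
        v = liftVec R L n w ζ k

      liftEntry : BlockIndex → Carrier
      liftEntry (inj₁ (i , r)) = w (i ↑ˡ 1) * z r
      liftEntry (inj₂ _)       = 0#

      liftVec≡liftEntry : ∀ a → v a ≡ liftEntry (idx a)
      liftVec≡liftEntry a with idx a
      ... | inj₁ _ = ≡.refl
      ... | inj₂ _ = ≡.refl

      bigD-liftVec : ∀ a → mulV R D v a ≈ sum (λ j → w (j ↑ˡ 1) * dot R (blockRow (idx a) j) z)
      bigD-liftVec a = begin
        mulV R D v a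
          ≈⟨ dot≈sum (D a) v ⟩
        sum (λ b → D a b * v b)
          ≡⟨ sum-cong-≗ {N} (λ b → ≡.cong₂ _*_ (bigD≡blockEntry a b) (liftVec≡liftEntry b)) ⟩
        sum (λ b → term (idx b))
          ≈⟨ sum-blockIdx term ⟩
        sum (λ j → sum (λ s → term (inj₁ (j , s)))) + sum (λ t → term (inj₂ t))
          ≈⟨ +-congˡ (sum≈0 {n} (λ t → zeroʳ (blockEntry (idx a) (inj₂ t)))) ⟩
        sum (λ j → sum (λ s → term (inj₁ (j , s)))) + 0#
          ≈⟨ +-identityʳ _ ⟩
        sum (λ j → sum (λ s → term (inj₁ (j , s))))
          ≈⟨ sum-cong-≋ {L} factor-w ⟩
        sum (λ j → w (j ↑ˡ 1) * dot R (blockRow (idx a) j) z)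
          ∎
        where
        term : BlockIndex → Carrier
        term p = blockEntry (idx a) p * liftEntry p
        factor-w : ∀ j → sum (λ s → term (inj₁ (j , s))) ≈ w (j ↑ˡ 1) * dot R (blockRow (idx a) j) z
        factor-w j = begin
          sum (λ s → blockRow (idx a) j s * (w (j ↑ˡ 1) * z s))
            ≈⟨ sum-cong-≋ {q} (λ s → x∙yz≈y∙xz _ _ _) ⟩
          sum (λ s → w (j ↑ˡ 1) * (blockRow (idx a) j s * z s))
            ≈⟨ *-distribˡ-sum (w (j ↑ˡ 1)) (λ s → blockRow (idx a) j s * z s) ⟨
          w (j ↑ˡ 1) * sum (λ s → blockRow (idx a) j s * z s)
            ≈⟨ *-congˡ (dot≈sum (blockRow (idx a) j) z) ⟨
          w (j ↑ˡ 1) * dot R (blockRow (idx a) j) z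
            ∎

      Dbar-↑ˡ-↑ˡ : ∀ ζn i j → Dbar R L n A X Y B ζ ζn k (i ↑ˡ 1) (j ↑ˡ 1) ≡ dot R (A i j) z
      Dbar-↑ˡ-↑ˡ ζn i j rewrite Finₚ.splitAt-↑ˡ L i 1 | Finₚ.splitAt-↑ˡ L j 1 = ≡.refl

      Dbar-lastColumn : ∀ ζn → k % 2 ≡ 1 → ∀ a t → Dbar R L n A X Y B ζ ζn k a (L ↑ʳ t) ≡ 0#
      Dbar-lastColumn ζn k-odd a t rewrite Finₚ.splitAt-↑ʳ L 1 t | k-odd with splitAt L a
      ... | inj₁ _ = ≡.refl
      ... | inj₂ _ = ≡.refl

      Dbar-eigen-row : ∀ {ζn λ'} → k % 2 ≡ 1 →
                       (∀ a → mulV R (Dbar R L n A X Y B ζ ζn k) w a ≈ λ' * w a) →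
                       ∀ i → sum (λ j → dot R (A i j) z * w (j ↑ˡ 1)) ≈ λ' * w (i ↑ˡ 1)
      Dbar-eigen-row {ζn} {λ'} k-odd eigen i = begin
        sum (λ j → dot R (A i j) z * w (j ↑ˡ 1))
          ≈⟨ +-identityʳ _ ⟨
        sum (λ j → dot R (A i j) z * w (j ↑ˡ 1)) + 0#
          ≈⟨ +-cong (reflexive (sum-cong-≗ {L} upper)) (sum≈0 {1} last) ⟨
        sum (λ j → Db (i ↑ˡ 1) (j ↑ˡ 1) * w (j ↑ˡ 1)) + sum (λ t → Db (i ↑ˡ 1) (L ↑ʳ t) * w (L ↑ʳ t))
          ≈⟨ sum-↑ˡ-↑ʳ L _ ⟨
        sum (λ b → Db (i ↑ˡ 1) b * w b)
          ≈⟨ dot≈sum (Db (i ↑ˡ 1)) w ⟨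
        mulV R Db w (i ↑ˡ 1)
          ≈⟨ eigen (i ↑ˡ 1) ⟩
        λ' * w (i ↑ˡ 1)
          ∎
        where
        Db : Mat R (L ℕ.+ 1) (L ℕ.+ 1)
        Db = Dbar R L n A X Y B ζ ζn k
        upper : ∀ j → Db (i ↑ˡ 1) (j ↑ˡ 1) * w (j ↑ˡ 1) ≡ dot R (A i j) z * w (j ↑ˡ 1)
        upper j = ≡.cong (_* w (j ↑ˡ 1)) (Dbar-↑ˡ-↑ˡ ζn i j)
        last : ∀ t → Db (i ↑ˡ 1) (L ↑ʳ t) * w (L ↑ʳ t) ≈ 0#
        last t = trans (*-congʳ (reflexive (Dbar-lastColumn ζn k-odd (i ↑ˡ 1) t))) (zeroˡ _)

      bigD-liftVec-eigen : ∀ {λ'} → pow R ζ q ≈ 1# → pow R ζ (n ℕ.* k) ≈ - 1# →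
                           (∀ i → sum (λ j → dot R (A i j) z * w (j ↑ˡ 1)) ≈ λ' * w (i ↑ˡ 1)) →
                           ∀ a → mulV R D v a ≈ λ' * v a
      bigD-liftVec-eigen {λ'} ζ^2n≈1 ζ^nk≈-1 upper-rows a = begin
        mulV R D v a                                           ≈⟨ bigD-liftVec a ⟩
        sum (λ j → w (j ↑ˡ 1) * dot R (blockRow (idx a) j) z)  ≈⟨ block-row (idx a) ⟩
        λ' * liftEntry (idx a)                                 ≡⟨ ≡.cong (λ' *_) (liftVec≡liftEntry a) ⟨
        λ' * v a                                               ∎
        where
        block-row : ∀ p → sum (λ j → w (j ↑ˡ 1) * dot R (blockRow p j) z) ≈ λ' * liftEntry p
        block-row (inj₁ (i , r)) = begin
          sum (λ j → w (j ↑ˡ 1) * mulV R (circ R (A i j)) z r)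
            ≈⟨ sum-cong-≋ {L} (λ j → *-congˡ (circ-zvec ζ^2n≈1 k (A i j) r)) ⟩
          sum (λ j → w (j ↑ˡ 1) * (z r * dot R (A i j) z))
            ≈⟨ sum-cong-≋ {L} (λ j → x∙yz≈y∙zx _ _ _) ⟩
          sum (λ j → z r * (dot R (A i j) z * w (j ↑ˡ 1)))
            ≈⟨ *-distribˡ-sum (z r) (λ j → dot R (A i j) z * w (j ↑ˡ 1)) ⟨
          z r * sum (λ j → dot R (A i j) z * w (j ↑ˡ 1))
            ≈⟨ *-congˡ (upper-rows i) ⟩
          z r * (λ' * w (i ↑ˡ 1))
            ≈⟨ x∙yz≈y∙zx _ _ _ ⟩
          λ' * (w (i ↑ˡ 1) * z r)
            ∎
        block-row (inj₂ r) = begin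
          sum (λ j → w (j ↑ˡ 1) * dot R (λ s → circ R (Y j) r (fold2 R n s)) z)
            ≈⟨ sum≈0 {L} (λ j → trans (*-congˡ (dot-fold2-zvec≈0 n k ζ^nk≈-1 (circ R (Y j) r))) (zeroʳ _)) ⟩
          0#
            ≈⟨ zeroʳ λ' ⟨
          λ' * 0#
            ∎

      liftVec-nonzero : ¬ (1# ≈ 0#) → 0 < n → LinIndep R w (lastUnit R L) → ¬ (∀ a → v a ≈ 0#)
      liftVec-nonzero 1≉0 0<n independent v≈0 = 1≉0 (proj₁ (independent 1# (- w-last) w-w-last·e≈0))
        where
        s₀ : Fin q
        s₀ = fromℕ< (ℕₚ.<-≤-trans 0<n (ℕₚ.m≤m+n n n))
        w-upper≈0 : ∀ j → w (j ↑ˡ 1) ≈ 0#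
        w-upper≈0 j = begin
          w (j ↑ˡ 1)
            ≈⟨ *-identityʳ _ ⟨
          w (j ↑ˡ 1) * 1#
            ≡⟨ ≡.cong (λ t → w (j ↑ˡ 1) * pow R ζ (t ℕ.* k)) (Finₚ.toℕ-fromℕ< {0} {q} _) ⟨
          liftEntry (inj₁ (j , s₀))
            ≡⟨ ≡.trans (liftVec≡liftEntry _) (≡.cong liftEntry (blockIdx-combine j s₀)) ⟨
          v (combine {L} {q} j s₀ ↑ˡ n)
            ≈⟨ v≈0 _ ⟩
          0#
            ∎
        w-last : Carrier
        w-last = w (L ↑ʳ Fin.zero)
        w-w-last·e≈0 : ∀ x → 1# * w x + - w-last * lastUnit R L x ≈ 0#
        w-w-last·e≈0 x with splitAt L x in eq
        ... | inj₁ j = begin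
          1# * w x + - w-last * 0#  ≈⟨ +-cong (*-identityˡ _) (zeroʳ _) ⟩
          w x + 0#                  ≈⟨ +-identityʳ _ ⟩
          w x                       ≡⟨ ≡.cong w (Finₚ.splitAt⁻¹-↑ˡ eq) ⟨
          w (j ↑ˡ 1)                ≈⟨ w-upper≈0 j ⟩
          0#                        ∎
        ... | inj₂ Fin.zero = begin
          1# * w x + - w-last * 1#  ≈⟨ +-cong (*-identityˡ _) (*-identityʳ _) ⟩
          w x - w-last              ≡⟨ ≡.cong (λ y → w y - w-last) (Finₚ.splitAt⁻¹-↑ʳ eq) ⟨
          w-last - w-last           ≈⟨ -‿inverseʳ w-last ⟩
          0#                        ∎

open import Data.Nat using (_+_)

lemma2p7 : ∀ {c ℓ} (R : CommutativeRing c ℓ) → IsField R →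
    (L n : ℕ) → .{{_ : NonZero n}} →
    (ζ2n ζn : CommutativeRing.Carrier R) →
    IsPrimitiveRoot R (n + n) ζ2n → IsPrimitiveRoot R n ζn →
    (A : Fin L → Fin L → Vect R (n + n)) → (X Y : Fin L → Vect R n) → (B : Vect R n) →
    (k : ℕ) → k < n + n → k % 2 ≡ 1 →
    (λ' : CommutativeRing.Carrier R) → (w : Vect R (L + 1)) →
    IsEigenvector R (Dbar R L n A X Y B ζ2n ζn k) λ' w →
    LinIndep R w (lastUnit R L) →
    IsEigenvector R (bigD R L n A X Y B) λ' (liftVec R L n w ζ2n k)
lemma2p7 R isField L n ζ2n _ ζ2n-primitive _ A X Y B k _ k-odd λ' w (_ , w-eigen) independent =
  liftVec-nonzero ζ2n k w (proj₁ isField) 0<n independent ,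
  bigD-liftVec-eigen ζ2n k w (proj₁ ζ2n-primitive) ζ2n^nk≈-1 (Dbar-eigen-row ζ2n k w k-odd w-eigen)
  where
  open CommutativeRing R using (_≈_; -_; 1#; trans)
  open BlockMatrix R L n A X Y B
  0<n : 0 < n
  0<n = ℕ.>-nonZero⁻¹ n
  ζ2n^nk≈-1 : pow R ζ2n (n ℕ.* k) ≈ - 1#
  ζ2n^nk≈-1 = trans (pow-*-odd R n (proj₁ ζ2n-primitive) k k-odd)
                    (primitiveRoot-pow-half R isField n 0<n ζ2n-primitive)
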